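{- Let $G$ be a connected symmetric graph of order $n\geq 2$ and let $n'$ be the number of its saturated vertices. Then $F_{xt}(G)\leq n-n'+2$. This bound is sharp.
   Context: All graphs are finite and simple. A graph is symmetric if its automorphism group is nontrivial. A vertex is saturated if it is adjacent to all other vertices. A fixing set of $G$ is a set $F\subseteq V(G)$ such that the only automorphism of $G$ fixing every vertex of $F$ is the identity. A fixatic partition of $G$ is a partition of $V(G)$ into classes each of which is a fixing set; $F_{xt}(G)$ is the maximum number of classes in a fixatic partition. -}

module Defs where

open import Data.Nat using (ℕ; _≤_; _+_; _∸_)
open import Data.Bool using (Bool; true; false)
open import Data.Fin using (Fin; _≟_)
open import Data.Fin.Properties using (all?)
open import Data.Fin.Permutation using (Permutation′; _⟨$⟩ʳ_)
open import Data.Product using (Σ; ∃; _×_; _,_)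
open import Data.List using (length; filter; allFin)
open import Data.List.Base using ()
open import Data.Fin.Base using ()
open import Data.Vec using ()
open import Relation.Nullary using (¬_; Dec; yes; no)
open import Relation.Nullary.Decidable using (_→-dec_; ¬?)
open import Relation.Binary.PropositionalEquality using (_≡_; _≢_)
open import Data.Bool.Properties using () renaming (_≟_ to _≟ᵇ_)
import Data.List as L

record Graph (n : ℕ) : Set where
  field
    adj   : Fin n → Fin n → Bool
    sym   : ∀ i j → adj i j ≡ adj j i
    irrefl : ∀ i → adj i i ≡ false
open Graph public

module _ {n : ℕ} (G : Graph n) where

  Adj : Fin n → Fin n → Set
  Adj i j = adj G i j ≡ true

  data Reachable : Fin n → Fin n → Set where
    here : ∀ {i} → Reachable i i
    step : ∀ {i j k} → Adj i j → Reachable j k → Reachable i k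

  Connected : Set
  Connected = ∀ i j → Reachable i j

  IsAutomorphism : Permutation′ n → Set
  IsAutomorphism σ = ∀ i j → adj G (σ ⟨$⟩ʳ i) (σ ⟨$⟩ʳ j) ≡ adj G i j

  IsIdentity : Permutation′ n → Set
  IsIdentity σ = ∀ i → σ ⟨$⟩ʳ i ≡ i

  Symmetric : Set
  Symmetric = Σ (Permutation′ n) λ σ → IsAutomorphism σ × ¬ IsIdentity σ

  Saturated : Fin n → Set
  Saturated i = ∀ j → j ≢ i → Adj i j

  saturated? : ∀ i → Dec (Saturated i)
  saturated? i = all? (λ j → ¬? (j ≟ i) →-dec (adj G i j ≟ᵇ true))

  numSaturated : ℕ
  numSaturated = length (filter saturated? (allFin n))

  FixingSet : (Fin n → Set) → Set
  FixingSet F = ∀ σ → IsAutomorphism σ → (∀ v → F v → σ ⟨$⟩ʳ v ≡ v) → IsIdentity σ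

  -- A fixatic partition into k classes, given by a surjective class map
  -- c : V(G) → Fin k (surjectivity = all k classes nonempty),
  -- each class c⁻¹(t) being a fixing set.
  FixaticPartition : (k : ℕ) → (Fin n → Fin k) → Set
  FixaticPartition k c =
    (∀ t → ∃ λ v → c v ≡ t) × (∀ t → FixingSet (λ v → c v ≡ t))

  HasFixaticPartition : ℕ → Set
  HasFixaticPartition k = Σ (Fin n → Fin k) (FixaticPartition k)

  IsFxt : ℕ → Set
  IsFxt k = HasFixaticPartition k × (∀ m → HasFixaticPartition m → m ≤ k)

module Submission where

-- Let n' be the number of saturated vertices of G.
--   * If n' ≤ 1, the bound is the trivial one: the classes of a fixatic
--     partition are nonempty and disjoint, so there are at most
--     n ≤ n - n' + 2 of them.
--   * If n' ≥ 2, pick distinct saturated vertices u and v.  The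
--     transposition (u v) is a nontrivial automorphism fixing every other
--     vertex, so every fixing set contains u or v.  Hence every class of a
--     fixatic partition contains u or v, and there are at most 2 classes.
-- The upper bound thus holds for every graph; connectedness, symmetry and
-- n ≥ 2 are only needed to make the sharpness example meaningful.
-- Sharpness is witnessed by K₂: n = n' = 2, and the partition into the two
-- singletons is fixatic, so F_xt(K₂) = 2 = n - n' + 2.

open import Defs
open import Data.Nat using (ℕ; _≤_; _+_; _∸_; z≤n; s≤s; s≤s⁻¹)
open import Data.Nat.Properties
  using (≤-trans; m≤n+m; m≤n+m∸n; +-comm; +-monoʳ-≤; ≰⇒>; _≤?_; module ≤-Reasoning)
open import Data.Product using (Σ; ∃; ∃₂; _×_; _,_; proj₁; proj₂)
open import Data.Sum using (_⊎_; inj₁; inj₂)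
open import Data.Bool using (Bool; true; false)
open import Data.Empty using (⊥-elim)
open import Data.Fin using (Fin; _≟_)
open import Data.Fin.Patterns using (0F; 1F)
open import Data.Fin.Properties using (injective⇒≤)
open import Data.Fin.Permutation using (Permutation′; _⟨$⟩ʳ_; transpose)
open import Data.List using (List; []; _∷_; length; filter; allFin)
open import Data.List.Relation.Unary.All using (All; _∷_)
open import Data.List.Relation.Unary.All.Properties using (all-filter)
open import Data.List.Relation.Unary.AllPairs using (_∷_)
open import Data.List.Relation.Unary.Unique.Propositional using (Unique)
open import Data.List.Relation.Unary.Unique.Propositional.Properties using (allFin⁺; filter⁺)
open import Function using (_∘_)
open import Function.Bundles using (Injection)
open import Function.Properties.Inverse using (↔⇒↣)
open import Relation.Nullary using (¬_; Dec; yes; no)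
open import Relation.Binary.PropositionalEquality
  using (_≡_; _≢_; refl; trans; cong; module ≡-Reasoning)
  renaming (sym to ≡-sym)

-- A surjection Fin n → Fin k forces k ≤ n: choosing a preimage of each
-- t gives an injection Fin k → Fin n.  (A partition of n vertices into k
-- nonempty classes has at most n classes.)
surjection⇒≤ : ∀ {n k} (c : Fin n → Fin k) → (∀ t → ∃ λ v → c v ≡ t) → k ≤ n
surjection⇒≤ {n} {k} c surj = injective⇒≤ {f = preimage} preimage-injective
  where
  preimage : Fin k → Fin n
  preimage t = proj₁ (surj t)

  preimage-injective : ∀ {s t} → preimage s ≡ preimage t → s ≡ t
  preimage-injective {s} {t} e = begin
    s                ≡⟨ ≡-sym (proj₂ (surj s)) ⟩
    c (preimage s)   ≡⟨ cong c e ⟩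
    c (preimage t)   ≡⟨ proj₂ (surj t) ⟩
    t                ∎
    where open ≡-Reasoning

-- If every class of c contains u or v, there are at most two classes:
-- the map 0 ↦ c u, 1 ↦ c v is then a surjection Fin 2 → Fin k.
classesMeetingPair≤2 : ∀ {n k} (c : Fin n → Fin k) (u v : Fin n) →
                       (∀ t → c u ≡ t ⊎ c v ≡ t) → k ≤ 2
classesMeetingPair≤2 {k = k} c u v meets = surjection⇒≤ pairClass pairClass-surjective
  where
  pairClass : Fin 2 → Fin k
  pairClass 0F = c u
  pairClass 1F = c v

  pairClass-surjective : ∀ t → ∃ λ i → pairClass i ≡ t
  pairClass-surjective t with meets t
  ... | inj₁ cu≡t = 0F , cu≡t
  ... | inj₂ cv≡t = 1F , cv≡t

twoDistinctMembers : ∀ {a p} {A : Set a} {P : A → Set p} (xs : List A) →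
                     All P xs → Unique xs → 2 ≤ length xs →
                     ∃₂ λ u v → P u × P v × u ≢ v
twoDistinctMembers [] _ _ ()
twoDistinctMembers (_ ∷ []) _ _ (s≤s ())
twoDistinctMembers (u ∷ v ∷ _) (Pu ∷ Pv ∷ _) ((u≢v ∷ _) ∷ _) _ = u , v , Pu , Pv , u≢v

order≤boundWhenFewSaturated : ∀ n {m} → m ≤ 1 → n ≤ n ∸ m + 2
order≤boundWhenFewSaturated n {m} m≤1 = begin
  n              ≤⟨ m≤n+m∸n n m ⟩
  m + (n ∸ m)    ≡⟨ +-comm m (n ∸ m) ⟩
  n ∸ m + m      ≤⟨ +-monoʳ-≤ (n ∸ m) (≤-trans m≤1 (s≤s z≤n)) ⟩
  n ∸ m + 2      ∎
  where open ≤-Reasoning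

permutation-injective : ∀ {n} (σ : Permutation′ n) {i j} → σ ⟨$⟩ʳ i ≡ σ ⟨$⟩ʳ j → i ≡ j
permutation-injective σ = Injection.injective (↔⇒↣ σ)

-- A permutation fixing all vertices but one fixes that one too, since its
-- image is not taken by any other vertex.
fixAllButOne⇒identity : ∀ {n} (σ : Permutation′ n) (x : Fin n) →
                        (∀ w → w ≢ x → σ ⟨$⟩ʳ w ≡ w) → ∀ w → σ ⟨$⟩ʳ w ≡ w
fixAllButOne⇒identity σ x fixes w with w ≟ x
... | no w≢x = fixes w w≢x
... | yes refl with σ ⟨$⟩ʳ w ≟ w
...   | yes σw≡w = σw≡w
...   | no σw≢w = ⊥-elim (σw≢w (permutation-injective σ (fixes (σ ⟨$⟩ʳ w) σw≢w)))

module _ {n : ℕ} (G : Graph n) where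

  fixingSetMeetsSupport : (σ : Permutation′ n) → IsAutomorphism G σ → ¬ IsIdentity G σ →
                          (u v : Fin n) → (∀ w → w ≢ u → w ≢ v → σ ⟨$⟩ʳ w ≡ w) →
                          (F : Fin n → Set) → Dec (F u) → Dec (F v) →
                          FixingSet G F → F u ⊎ F v
  fixingSetMeetsSupport σ aut nontrivial u v support F (yes Fu) _ _ = inj₁ Fu
  fixingSetMeetsSupport σ aut nontrivial u v support F (no _) (yes Fv) _ = inj₂ Fv
  fixingSetMeetsSupport σ aut nontrivial u v support F (no ¬Fu) (no ¬Fv) fixing =
    ⊥-elim (nontrivial (fixing σ aut fixesF))
    where
    fixesF : ∀ w → F w → σ ⟨$⟩ʳ w ≡ w
    fixesF w Fw = support w (λ { refl → ¬Fu Fw }) (λ { refl → ¬Fv Fw })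

  -- Swapping two saturated vertices u and v is an automorphism: both are
  -- adjacent to everything, so any pair involving them is an edge before
  -- and after the swap, and all other pairs are untouched.
  module SaturatedSwap (u v : Fin n) (u-sat : Saturated G u) (v-sat : Saturated G v) where

    InPair : Fin n → Set
    InPair w = w ≡ u ⊎ w ≡ v

    swap : Permutation′ n
    swap = transpose u v

    swap-u : swap ⟨$⟩ʳ u ≡ v
    swap-u with u ≟ u
    ... | yes _ = refl
    ... | no u≢u = ⊥-elim (u≢u refl)

    swap-fixes : ∀ w → w ≢ u → w ≢ v → swap ⟨$⟩ʳ w ≡ w
    swap-fixes w w≢u w≢v with w ≟ u
    ... | yes w≡u = ⊥-elim (w≢u w≡u)
    ... | no _ with w ≟ v
    ...   | yes w≡v = ⊥-elim (w≢v w≡v)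
    ...   | no _ = refl

    swap-cases : ∀ w → (InPair w × InPair (swap ⟨$⟩ʳ w)) ⊎ swap ⟨$⟩ʳ w ≡ w
    swap-cases w with w ≟ u
    ... | yes w≡u = inj₁ (inj₁ w≡u , inj₂ refl)
    ... | no _ with w ≟ v
    ...   | yes w≡v = inj₁ (inj₂ w≡v , inj₁ refl)
    ...   | no _ = inj₂ refl

    pairSaturated : ∀ {w} → InPair w → Saturated G w
    pairSaturated (inj₁ refl) = u-sat
    pairSaturated (inj₂ refl) = v-sat

    touchingPair⇒adjacent : ∀ x y → InPair x ⊎ InPair y → x ≢ y → adj G x y ≡ true
    touchingPair⇒adjacent x y (inj₁ px) x≢y = pairSaturated px y (x≢y ∘ ≡-sym)
    touchingPair⇒adjacent x y (inj₂ py) x≢y = trans (Graph.sym G x y) (pairSaturated py x x≢y)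

    swapPreservesTouchingPair : ∀ {i j} → i ≢ j →
      InPair (swap ⟨$⟩ʳ i) ⊎ InPair (swap ⟨$⟩ʳ j) → InPair i ⊎ InPair j →
      adj G (swap ⟨$⟩ʳ i) (swap ⟨$⟩ʳ j) ≡ adj G i j
    swapPreservesTouchingPair {i} {j} i≢j after before =
      trans (touchingPair⇒adjacent _ _ after (i≢j ∘ permutation-injective swap))
            (≡-sym (touchingPair⇒adjacent i j before i≢j))

    swap-automorphism : IsAutomorphism G swap
    swap-automorphism i j with i ≟ j
    ... | yes refl = trans (irrefl G (swap ⟨$⟩ʳ i)) (≡-sym (irrefl G i))
    ... | no i≢j with swap-cases i | swap-cases j
    ...   | inj₁ (pi , pσi) | _ = swapPreservesTouchingPair i≢j (inj₁ pσi) (inj₁ pi)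
    ...   | inj₂ _ | inj₁ (pj , pσj) = swapPreservesTouchingPair i≢j (inj₂ pσj) (inj₂ pj)
    ...   | inj₂ σi≡i | inj₂ σj≡j rewrite σi≡i | σj≡j = refl

    swap-nontrivial : u ≢ v → ¬ IsIdentity G swap
    swap-nontrivial u≢v identity = u≢v (trans (≡-sym (identity u)) swap-u)

  twoSaturated⇒atMostTwoClasses : ∀ {u v} → Saturated G u → Saturated G v → u ≢ v →
    ∀ {k} (c : Fin n → Fin k) → (∀ t → FixingSet G (λ w → c w ≡ t)) → k ≤ 2
  twoSaturated⇒atMostTwoClasses {u} {v} u-sat v-sat u≢v c fixing =
    classesMeetingPair≤2 c u v λ t →
      fixingSetMeetsSupport swap swap-automorphism (swap-nontrivial u≢v) u v swap-fixes
        (λ w → c w ≡ t) (c u ≟ t) (c v ≟ t) (fixing t)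
    where open SaturatedSwap u v u-sat v-sat

  -- n' ≥ 2 yields two distinct saturated vertices (the saturated vertices
  -- are listed without repetition).
  twoSaturatedVertices : 2 ≤ numSaturated G →
                         ∃₂ λ u v → Saturated G u × Saturated G v × u ≢ v
  twoSaturatedVertices =
    twoDistinctMembers (filter (saturated? G) (allFin n))
      (all-filter (saturated? G) (allFin n)) (filter⁺ (saturated? G) (allFin⁺ n))

  fxt≤bound : ∀ k → IsFxt G k → k ≤ n ∸ numSaturated G + 2
  fxt≤bound k ((c , surjective , fixing) , _) with 2 ≤? numSaturated G
  ... | yes two≤n' =
        let (u , v , u-sat , v-sat , u≢v) = twoSaturatedVertices two≤n'
        in ≤-trans (twoSaturated⇒atMostTwoClasses u-sat v-sat u≢v c fixing)
                   (m≤n+m 2 (n ∸ numSaturated G))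
  ... | no two≰n' =
        ≤-trans (surjection⇒≤ c surjective)
                (order≤boundWhenFewSaturated n (s≤s⁻¹ (≰⇒> two≰n')))

K₂ : Graph 2
K₂ = record { adj = edge ; sym = edge-sym ; irrefl = edge-irrefl }
  where
  edge : Fin 2 → Fin 2 → Bool
  edge 0F 0F = false
  edge 0F 1F = true
  edge 1F 0F = true
  edge 1F 1F = false

  edge-sym : ∀ i j → edge i j ≡ edge j i
  edge-sym 0F 0F = refl
  edge-sym 0F 1F = refl
  edge-sym 1F 0F = refl
  edge-sym 1F 1F = refl

  edge-irrefl : ∀ i → edge i i ≡ false
  edge-irrefl 0F = refl
  edge-irrefl 1F = refl

K₂-saturated : ∀ i → Saturated K₂ i
K₂-saturated 0F 0F 0≢0 = ⊥-elim (0≢0 refl)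
K₂-saturated 0F 1F _ = refl
K₂-saturated 1F 0F _ = refl
K₂-saturated 1F 1F 1≢1 = ⊥-elim (1≢1 refl)

K₂-connected : Connected K₂
K₂-connected 0F 0F = here
K₂-connected 0F 1F = step refl here
K₂-connected 1F 0F = step refl here
K₂-connected 1F 1F = here

K₂-symmetric : Symmetric K₂
K₂-symmetric = swap , swap-automorphism , swap-nontrivial (λ ())
  where open SaturatedSwap K₂ 0F 1F (K₂-saturated 0F) (K₂-saturated 1F)

otherVertex : Fin 2 → Fin 2
otherVertex 0F = 1F
otherVertex 1F = 0F

notOther⇒same : ∀ t w → w ≢ otherVertex t → w ≡ t
notOther⇒same 0F 0F _ = refl
notOther⇒same 0F 1F w≢1 = ⊥-elim (w≢1 refl)
notOther⇒same 1F 0F w≢0 = ⊥-elim (w≢0 refl)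
notOther⇒same 1F 1F _ = refl

-- Every single vertex of K₂ is a fixing set: fixing it fixes all vertices
-- but the other one, which is then fixed as well.
K₂-singletonFixing : ∀ t → FixingSet K₂ (λ w → w ≡ t)
K₂-singletonFixing t σ _ fixesT =
  fixAllButOne⇒identity σ (otherVertex t) (λ w w≢ → fixesT w (notOther⇒same t w w≢))

K₂-fxt : IsFxt K₂ 2
K₂-fxt = ((λ w → w) , (λ t → t , refl) , K₂-singletonFixing) ,
         (λ m (c , surjective , _) → surjection⇒≤ c surjective)

mainTheorem7 :
    ((n : ℕ) → (G : Graph n) → 2 ≤ n → Connected G → Symmetric G →
      (k : ℕ) → IsFxt G k → k ≤ n ∸ numSaturated G + 2)
    ×
    Σ ℕ (λ n → Σ (Graph n) (λ G → Σ ℕ (λ k →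
      2 ≤ n × Connected G × Symmetric G × IsFxt G k ×
      k ≡ n ∸ numSaturated G + 2)))
mainTheorem7 =
  (λ n G _ _ _ → fxt≤bound G) ,
  (2 , K₂ , 2 , s≤s (s≤s z≤n) , K₂-connected , K₂-symmetric , K₂-fxt , refl)
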